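{- Let $x$ be a factor of the Thue--Morse word $\mathbf{t}$ that begins with $1001$ and ends with $1001$, i.e. $x = 1001x'' = x'1001$ for some words $x', x''$. Then the word $x101100x101100$ is cubefree.
   Context: Let $\mu$ be the morphism on $\{0,1\}^*$ with $\mu(0)=01$, $\mu(1)=10$. The Thue--Morse word $\mathbf{t} = 011010011001011010010110\cdots$ is the infinite word obtained by iterating $\mu$ on $0$. A factor is a contiguous finite subword. A cube is a non-empty word of the form $uuu$; a word is cubefree if none of its factors is a cube. -}

module Defs where

open import Data.Bool using (Bool; true; false)
open import Data.List using (List; []; _∷_; _++_; concatMap)
open import Data.Nat using (ℕ; zero; suc)
open import Data.Product using (∃; ∃-syntax; _×_)
open import Relation.Nullary using (¬_)
open import Relation.Binary.PropositionalEquality using (_≡_; _≢_)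

-- Binary words: letter 0 is false, letter 1 is true.
Word : Set
Word = List Bool

μ-letter : Bool → Word
μ-letter false = false ∷ true ∷ []
μ-letter true  = true ∷ false ∷ []

μ : Word → Word
μ = concatMap μ-letter

-- μ^k(0); these are exactly the prefixes of length 2^k of the Thue–Morse word t.
μ^_[0] : ℕ → Word
μ^ zero  [0] = false ∷ []
μ^ suc k [0] = μ (μ^ k [0])

IsFactor : Word → Word → Set
IsFactor x w = ∃[ p ] ∃[ s ] (w ≡ p ++ x ++ s)

-- x is a factor of the infinite Thue–Morse word t
-- (every finite prefix of t is a prefix of some μ^k(0)).
FactorOfTM : Word → Set
FactorOfTM x = ∃[ k ] IsFactor x (μ^ k [0])

HasCube : Word → Set
HasCube w = ∃[ u ] (u ≢ [] × IsFactor (u ++ u ++ u) w)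

Cubefree : Word → Set
Cubefree w = ¬ HasCube w

w1001 : Word
w1001 = true ∷ false ∷ false ∷ true ∷ []

w101100 : Word
w101100 = true ∷ false ∷ true ∷ true ∷ false ∷ false ∷ []

module Submission where

--  1. Thue's theorem: μ preserves overlap-freeness (an overlap of even period in μ v
--     halves to one in v, and one of odd period is impossible by a parity count of the
--     blocks b (not b)); hence every μ^k(0) and each of its factors is overlap-free.
--  2. Desubstitution: 1001 occurs in a μ-image only at block boundaries, so x = μ y
--     for a factor y of t that begins and ends with 10.
--  3. The core (module CubeFreeness): for every overlap-free y = 10…10 the word
--     W = (μ y 101100)(μ y 101100) is cubefree. Reading W in blocks of two letters,
--     all blocks are mixed (b, not b) except the blocks 11 and 00 after each copy.
--     Odd periods are excluded by counting block parities, period 1 by inspecting the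
--     constant blocks, and even periods by reading the cube blockwise, which produces
--     an overlap in y.

open import Defs
open import Data.Bool using (Bool; true; false; not; _xor_)
open import Data.Bool.Properties using (not-involutive; not-injective; xor-same; xor-assoc)
open import Data.Empty using (⊥; ⊥-elim)
open import Data.List using (List; []; _∷_; _++_; length; concat; map)
open import Data.List.Properties using (length-++; ++-assoc; ∷-injective; ∷-injectiveʳ; map-++; concat-++)
open import Data.Maybe using (Maybe; just; nothing)
import Data.Maybe as Mb
open import Data.Maybe.Properties using (just-injective)
open import Data.Nat
open import Data.Nat.Properties
open import Data.Nat.Tactic.RingSolver
open import Data.Product using (∃-syntax; _,_; proj₁; proj₂; _×_; uncurry)
open import Data.Sum using (_⊎_; inj₁; inj₂)
open import Relation.Binary.PropositionalEquality
open import Relation.Nullary using (yes; no; does)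
open import Relation.Nullary.Decidable using (dec-true; dec-false)

infixl 9 _!_
_!_ : Word → ℕ → Maybe Bool
[] ! _ = nothing
(b ∷ w) ! zero = just b
(b ∷ w) ! suc n = w ! n

!-++ʳ : ∀ (u w : Word) j → (u ++ w) ! (length u + j) ≡ w ! j
!-++ʳ [] w j = refl
!-++ʳ (b ∷ u) w j = !-++ʳ u w j

!-++-prefix : ∀ (u w : Word) j → j < length u → (u ++ w) ! j ≡ u ! j
!-++-prefix (c ∷ u) w zero _ = refl
!-++-prefix (c ∷ u) w (suc j) (s≤s lt) = !-++-prefix u w j lt

!-valid : ∀ (w : Word) j → j < length w → ∃[ b ] (w ! j ≡ just b)
!-valid [] j ()
!-valid (b ∷ w) zero _ = b , refl
!-valid (b ∷ w) (suc j) (s≤s lt) = !-valid w j lt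

!-factor : ∀ (p u s : Word) k → k < length u → (p ++ u ++ s) ! (length p + k) ≡ u ! k
!-factor p u s k lt = trans (!-++ʳ p (u ++ s) k) (!-++-prefix u s k lt)

-- Doubling, defined by recursion so that double (suc n) ≡ suc (suc (double n))
-- definitionally; positions in μ v are naturally written 2k and 2k+1.
double : ℕ → ℕ
double zero = zero
double (suc n) = suc (suc (double n))

double≡+ : ∀ n → double n ≡ n + n
double≡+ zero = refl
double≡+ (suc n) = cong suc (trans (cong suc (double≡+ n)) (sym (+-suc n n)))

double-+ : ∀ a b → double (a + b) ≡ double a + double b
double-+ zero b = refl
double-+ (suc a) b = cong (λ z → suc (suc z)) (double-+ a b)

double-mono-≤ : ∀ {a b} → a ≤ b → double a ≤ double b
double-mono-≤ z≤n = z≤n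
double-mono-≤ (s≤s le) = s≤s (s≤s (double-mono-≤ le))

double-cancel-≤ : ∀ a b → double a ≤ double b → a ≤ b
double-cancel-≤ zero b _ = z≤n
double-cancel-≤ (suc a) zero ()
double-cancel-≤ (suc a) (suc b) (s≤s (s≤s le)) = s≤s (double-cancel-≤ a b le)

double-cancel-< : ∀ a b → suc (double a) ≤ double b → a < b
double-cancel-< a zero ()
double-cancel-< zero (suc b) _ = s≤s z≤n
double-cancel-< (suc a) (suc b) (s≤s (s≤s le)) = s≤s (double-cancel-< a b le)

even-or-odd : ∀ n → (∃[ h ] n ≡ double h) ⊎ (∃[ h ] n ≡ suc (double h))
even-or-odd zero = inj₁ (0 , refl)
even-or-odd (suc n) with even-or-odd n
... | inj₁ (h , e) = inj₂ (h , cong suc e)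
... | inj₂ (h , e) = inj₁ (suc h , cong suc e)

below-or-above : ∀ k n → k < n ⊎ ∃[ d ] (n + d ≡ k)
below-or-above k n with k <? n
... | yes lt = inj₁ lt
... | no nlt = inj₂ (m≤n⇒∃[o]m+o≡n (≮⇒≥ nlt))

odd-4≤⇒5≤ : ∀ h → 4 ≤ suc (double (suc h)) → 5 ≤ suc (double (suc h))
odd-4≤⇒5≤ zero (s≤s (s≤s (s≤s ())))
odd-4≤⇒5≤ (suc h) _ = s≤s (s≤s (s≤s (s≤s (s≤s z≤n))))

next-even : ∀ i → ∃[ a ] ∃[ d ] (double a ≡ i + d × d ≤ 1)
next-even i with even-or-odd i
... | inj₁ (a , e) = a , 0 , trans (sym e) (sym (+-identityʳ i)) , z≤n
... | inj₂ (a , e) = suc a , 1 , trans (cong suc (sym e)) (sym (+-comm i 1)) , s≤s z≤n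

length-μ : ∀ v → length (μ v) ≡ double (length v)
length-μ [] = refl
length-μ (false ∷ v) = cong (λ z → suc (suc z)) (length-μ v)
length-μ (true ∷ v) = cong (λ z → suc (suc z)) (length-μ v)

μ-!-even : ∀ v k → μ v ! double k ≡ v ! k
μ-!-even [] k = refl
μ-!-even (false ∷ v) zero = refl
μ-!-even (true ∷ v) zero = refl
μ-!-even (false ∷ v) (suc k) = μ-!-even v k
μ-!-even (true ∷ v) (suc k) = μ-!-even v k

μ-!-odd : ∀ v k → μ v ! suc (double k) ≡ Mb.map not (v ! k)
μ-!-odd [] k = refl
μ-!-odd (false ∷ v) zero = refl
μ-!-odd (true ∷ v) zero = refl
μ-!-odd (false ∷ v) (suc k) = μ-!-odd v k
μ-!-odd (true ∷ v) (suc k) = μ-!-odd v k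

mapNot-injective : ∀ {x y : Maybe Bool} → Mb.map not x ≡ Mb.map not y → x ≡ y
mapNot-injective {just a} {just b} e = cong just (not-injective (just-injective e))
mapNot-injective {nothing} {nothing} e = refl
mapNot-injective {just _} {nothing} ()
mapNot-injective {nothing} {just _} ()

μ-!-reflects : ∀ v r k k' → r ≤ 1 → μ v ! (r + double k) ≡ μ v ! (r + double k') → v ! k ≡ v ! k'
μ-!-reflects v zero k k' _ e = trans (sym (μ-!-even v k)) (trans e (μ-!-even v k'))
μ-!-reflects v (suc zero) k k' _ e = mapNot-injective (trans (sym (μ-!-odd v k)) (trans e (μ-!-odd v k')))
μ-!-reflects v (suc (suc r)) k k' (s≤s ())

-- The xor over a square uu vanishes, while the xor over an aligned range
-- of q blocks of μ v is the parity of q (each block b (not b) contributes 1).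
bit : Maybe Bool → Bool
bit (just b) = b
bit nothing = false

rangeXor : Word → ℕ → ℕ → Bool
rangeXor w e zero = false
rangeXor w e (suc L) = bit (w ! e) xor rangeXor w (suc e) L

rangeXor-split : ∀ w e p L → rangeXor w e (p + L) ≡ rangeXor w e p xor rangeXor w (e + p) L
rangeXor-split w e zero L = cong (λ z → rangeXor w z L) (sym (+-identityʳ e))
rangeXor-split w e (suc p) L =
  trans (cong (bit (w ! e) xor_) (trans (rangeXor-split w (suc e) p L)
          (cong (λ z → rangeXor w (suc e) p xor rangeXor w z L) (sym (+-suc e p)))))
        (sym (xor-assoc (bit (w ! e)) (rangeXor w (suc e) p) (rangeXor w (e + suc p) L)))

rangeXor-cong : ∀ w e e' L → (∀ t → t < L → w ! (e + t) ≡ w ! (e' + t)) →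
                rangeXor w e L ≡ rangeXor w e' L
rangeXor-cong w e e' zero h = refl
rangeXor-cong w e e' (suc L) h =
  cong₂ _xor_ (cong bit (trans (cong (w !_) (sym (+-identityʳ e)))
                        (trans (h 0 (s≤s z≤n)) (cong (w !_) (+-identityʳ e')))))
              (rangeXor-cong w (suc e) (suc e') L (λ t lt →
                 trans (cong (w !_) (sym (+-suc e t)))
                 (trans (h (suc t) (s≤s lt)) (cong (w !_) (+-suc e' t)))))

rangeXor-square : ∀ w e p → (∀ t → t < p → w ! (e + t) ≡ w ! (e + p + t)) →
                  rangeXor w e (p + p) ≡ false
rangeXor-square w e p h = trans (rangeXor-split w e p p)
  (trans (cong (rangeXor w e p xor_) (sym (rangeXor-cong w e (e + p) p h))) (xor-same (rangeXor w e p)))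

blockXor : Word → ℕ → ℕ → Bool
blockXor w a zero = false
blockXor w a (suc r) = (bit (w ! double a) xor bit (w ! suc (double a))) xor blockXor w (suc a) r

rangeXor-blocks : ∀ w a r → rangeXor w (double a) (double r) ≡ blockXor w a r
rangeXor-blocks w a zero = refl
rangeXor-blocks w a (suc r) = trans (sym (xor-assoc (bit (w ! double a)) _ _))
  (cong ((bit (w ! double a) xor bit (w ! suc (double a))) xor_) (rangeXor-blocks w (suc a) r))

-- Boolean identities: a block b (not b) contributes 1, and the parity count of
-- blocks telescopes.
xor-not : ∀ b → b xor not b ≡ true
xor-not false = refl
xor-not true = refl

xor-telescope : ∀ a b r d → not (a xor b) xor (r xor (b xor d)) ≡ not r xor (a xor d)
xor-telescope false false false false = refl
xor-telescope false false false true = refl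
xor-telescope false false true false = refl
xor-telescope false false true true = refl
xor-telescope false true false false = refl
xor-telescope false true false true = refl
xor-telescope false true true false = refl
xor-telescope false true true true = refl
xor-telescope true false false false = refl
xor-telescope true false false true = refl
xor-telescope true false true false = refl
xor-telescope true false true true = refl
xor-telescope true true false false = refl
xor-telescope true true false true = refl
xor-telescope true true true false = refl
xor-telescope true true true true = refl

isOdd : ℕ → Bool
isOdd zero = false
isOdd (suc n) = not (isOdd n)

isOdd-odd : ∀ h → isOdd (suc (double h)) ≡ true
isOdd-odd zero = refl
isOdd-odd (suc h) = trans (not-involutive (not (isOdd (double h)))) (isOdd-odd h)

square-blockXor : ∀ w e d a p → double a ≡ e + d →
                  (∀ t → t < p → w ! (e + (d + t)) ≡ w ! (e + (d + t) + p)) → blockXor w a p ≡ false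
square-blockXor w e d a p e2a per = begin
    blockXor w a p                   ≡⟨ sym (rangeXor-blocks w a p) ⟩
    rangeXor w (double a) (double p) ≡⟨ cong (rangeXor w (double a)) (double≡+ p) ⟩
    rangeXor w (double a) (p + p)    ≡⟨ rangeXor-square w (double a) p square ⟩
    false ∎
  where
  open ≡-Reasoning
  square : ∀ t → t < p → w ! (double a + t) ≡ w ! (double a + p + t)
  square t lt = trans (cong (w !_) (trans (cong (_+ t) e2a) (+-assoc e d t)))
                (trans (per t lt) (cong (w !_) (trans (shuffle e d t p) (cong (λ z → z + p + t) (sym e2a)))))
    where
    shuffle : ∀ e d t p → e + (d + t) + p ≡ e + d + p + t
    shuffle = solve-∀

blockXor-μ : ∀ v a r → a + r ≤ length v → blockXor (μ v) a r ≡ isOdd r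
blockXor-μ v a zero _ = refl
blockXor-μ v a (suc r) le with !-valid v a (≤-trans (s≤s (m≤m+n a r)) (subst (_≤ length v) (+-suc a r) le))
... | b , e = trans (cong₂ _xor_ (cong₂ _xor_ (cong bit (trans (μ-!-even v a) e))
                                               (cong bit (trans (μ-!-odd v a) (cong (Mb.map not) e))))
                                  (blockXor-μ v (suc a) r (subst (_≤ length v) (+-suc a r) le)))
                    (block b)
  where
  block : ∀ b → (b xor not b) xor isOdd r ≡ not (isOdd r)
  block b = cong (_xor isOdd r) (xor-not b)

true≢false : true ≢ false
true≢false ()

xor-true-right : ∀ {a b} → a xor b ≡ true → a ≡ false → b ≡ true
xor-true-right {false} e _ = e

xor-true-other : ∀ {a b} → a xor b ≡ true → b ≡ false → a ≡ true
xor-true-other {true} {false} _ _ = refl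

-- Case split on a Boolean without abstracting it in the context.
true-or-false : ∀ b → b ≡ true ⊎ b ≡ false
true-or-false true = inj₁ refl
true-or-false false = inj₂ refl

Separates : (ℕ → Bool) → ℕ → ℕ → Set
Separates P p k = P k xor P (k + p) ≡ true

module Spaced (P : ℕ → Bool) (s : ℕ) (5≤s : 5 ≤ s)
              (spaced : ∀ k d → P k ≡ true → P (k + d) ≡ true → d ≡ 0 ⊎ d ≡ s) where

  no-gap : ∀ k d {k'} → k + d ≡ k' → 1 ≤ d → d < 5 → P k ≡ true → P k' ≡ true → ⊥
  no-gap k d refl 1≤d d<5 t t' with spaced k d t t'
  ... | inj₁ refl = <-irrefl refl 1≤d
  ... | inj₂ refl = <-irrefl refl (<-≤-trans d<5 5≤s)

  four≤ : ∀ {p} → suc p ≡ s → 4 ≤ p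
  four≤ e = ≤-pred (subst (5 ≤_) (sym e) 5≤s)

  no-separation : ∀ a p → 3 ≤ p → Separates P p a → Separates P p (suc a) →
                  (4 ≤ p → Separates P p (suc (suc a))) → ⊥
  no-separation a p@(suc (suc (suc p₀))) (s≤s (s≤s (s≤s _))) sep₀ sep₁ sep₂ with true-or-false (P a)
  ... | inj₁ e₀ with true-or-false (P (suc a))
  ...   | inj₁ e₁ = no-gap a 1 (+-comm a 1) (s≤s z≤n) (s≤s (s≤s z≤n)) e₀ e₁
  ...   | inj₂ e₁ with spaced a (suc p) e₀ (trans (cong P (+-suc a p)) (xor-true-right sep₁ e₁))
  ...     | inj₁ ()
  ...     | inj₂ e with true-or-false (P (suc (suc a)))
  ...       | inj₁ e₂ = no-gap a 2 (+-comm a 2) (s≤s z≤n) (s≤s (s≤s (s≤s z≤n))) e₀ e₂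
  ...       | inj₂ e₂ = no-gap (suc a + p) 1 (+-comm _ 1) (s≤s z≤n) (s≤s (s≤s z≤n))
                         (xor-true-right sep₁ e₁) (xor-true-right (sep₂ (four≤ e)) e₂)
  no-separation a p@(suc (suc (suc p₀))) (s≤s (s≤s (s≤s _))) sep₀ sep₁ sep₂ | inj₂ e₀
    with true-or-false (P (suc a + p))
  ... | inj₁ e₃ = no-gap (a + p) 1 (+-comm _ 1) (s≤s z≤n) (s≤s (s≤s z≤n)) (xor-true-right sep₀ e₀) e₃
  ... | inj₂ e₃ with spaced (suc a) (suc (suc p₀)) (xor-true-other sep₁ e₃)
                         (trans (cong P (sym (+-suc a (suc (suc p₀))))) (xor-true-right sep₀ e₀))
  ...   | inj₁ ()
  ...   | inj₂ e with true-or-false (P (suc (suc a)))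
  ...     | inj₁ e₂ = no-gap (suc a) 1 (+-comm _ 1) (s≤s z≤n) (s≤s (s≤s z≤n)) (xor-true-other sep₁ e₃) e₂
  ...     | inj₂ e₂ = no-gap (a + p) 2 (+-comm _ 2) (s≤s z≤n) (s≤s (s≤s (s≤s z≤n)))
                       (xor-true-right sep₀ e₀)
                       (xor-true-right (sep₂ (≤-trans (four≤ e) (≤-trans (n≤1+n _) (n≤1+n _)))) e₂)

HasPeriod : Word → ℕ → ℕ → ℕ → Set
HasPeriod w i q L = ∀ j → j + q < L → w ! (i + j) ≡ w ! (i + j + q)

OverlapFree : Word → Set
OverlapFree w = ∀ i q → 1 ≤ q → i + double q < length w → HasPeriod w i q (suc (double q)) → ⊥

μ-overlap-evenPeriod : ∀ v r a h → r ≤ 1 →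
  r + double a + double (double h) < length (μ v) →
  HasPeriod (μ v) (r + double a) (double h) (suc (double (double h))) →
  a + double h < length v × HasPeriod v a h (suc (double h))
μ-overlap-evenPeriod v r a h r≤1 bnd per = inside , period
  where
  inside : a + double h < length v
  inside = double-cancel-< (a + double h) (length v)
    (subst₂ (λ z w → suc z ≤ w) (sym (double-+ a (double h))) (length-μ v)
       (≤-trans (s≤s (m≤n+m (double a + double (double h)) r))
                (≤-trans (≤-reflexive (cong suc (sym (+-assoc r (double a) (double (double h)))))) bnd)))
  regroup : ∀ r x y z → r + ((x + y) + z) ≡ r + x + y + z
  regroup = solve-∀
  period : HasPeriod v a h (suc (double h))
  period j lt = μ-!-reflects v r (a + j) (a + j + h) r≤1 (begin
      μ v ! (r + double (a + j))                 ≡⟨ cong (λ z → μ v ! (r + z)) (double-+ a j) ⟩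
      μ v ! (r + (double a + double j))          ≡⟨ cong (μ v !_) (sym (+-assoc r (double a) (double j))) ⟩
      μ v ! (r + double a + double j)            ≡⟨ per (double j) within ⟩
      μ v ! (r + double a + double j + double h) ≡⟨ cong (μ v !_) (sym (regroup r (double a) (double j) (double h))) ⟩
      μ v ! (r + ((double a + double j) + double h)) ≡⟨ cong (λ z → μ v ! (r + (z + double h))) (sym (double-+ a j)) ⟩
      μ v ! (r + (double (a + j) + double h))    ≡⟨ cong (λ z → μ v ! (r + z)) (sym (double-+ (a + j) h)) ⟩
      μ v ! (r + double (a + j + h)) ∎)
    where
    open ≡-Reasoning
    within : double j + double h < suc (double (double h))
    within = s≤s (subst (_≤ double (double h)) (double-+ j h) (double-mono-≤ (≤-pred lt)))

-- μ v has no overlap of odd period q: the square of period q starting at the first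
-- even position inside the overlap covers q whole blocks, so its xor is isOdd q = true,
-- whereas the xor of a square is false.
μ-no-oddPeriod : ∀ v i h → i + double (suc (double h)) < length (μ v) →
                 HasPeriod (μ v) i (suc (double h)) (suc (double (suc (double h)))) → ⊥
μ-no-oddPeriod v i h bnd per with next-even i
... | a , d , e2a , d≤1 = true≢false (trans (sym blocksOfμ) blocksOfSquare)
  where
  q = suc (double h)
  inOverlap : ∀ t → t < q → d + t + q < suc (double q)
  inOverlap t lt = s≤s (subst (d + t + q ≤_) (sym (double≡+ q)) (+-monoˡ-≤ q (≤-trans (+-monoˡ-≤ t d≤1) lt)))
  blocksOfSquare : blockXor (μ v) a q ≡ false
  blocksOfSquare = square-blockXor (μ v) i d a q e2a (λ t lt → per (d + t) (inOverlap t lt))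
  fits : a + q ≤ length v
  fits = double-cancel-≤ (a + q) (length v) (begin
      double (a + q)      ≡⟨ trans (double-+ a q) (cong (_+ double q) e2a) ⟩
      i + d + double q    ≤⟨ +-monoˡ-≤ (double q) (+-monoʳ-≤ i d≤1) ⟩
      i + 1 + double q    ≡⟨ cong (_+ double q) (+-comm i 1) ⟩
      suc (i + double q)  ≤⟨ bnd ⟩
      length (μ v)        ≡⟨ length-μ v ⟩
      double (length v) ∎)
    where open ≤-Reasoning
  blocksOfμ : blockXor (μ v) a q ≡ true
  blocksOfμ = trans (blockXor-μ v a q fits) (isOdd-odd h)

μ-overlapFree : ∀ v → OverlapFree v → OverlapFree (μ v)
μ-overlapFree v ofv i q 1≤q bnd per with even-or-odd q
... | inj₂ (h , refl) = μ-no-oddPeriod v i h bnd per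
... | inj₁ (zero , refl) with 1≤q
...   | ()
μ-overlapFree v ofv i q 1≤q bnd per | inj₁ (suc h , refl) with even-or-odd i
... | inj₁ (a , refl) = uncurry (ofv a (suc h) (s≤s z≤n)) (μ-overlap-evenPeriod v 0 a (suc h) z≤n bnd per)
... | inj₂ (a , refl) = uncurry (ofv a (suc h) (s≤s z≤n)) (μ-overlap-evenPeriod v 1 a (suc h) (s≤s z≤n) bnd per)

thueMorse-overlapFree : ∀ k → OverlapFree (μ^ k [0])
thueMorse-overlapFree zero i (suc q) _ bnd per with m+n≤o⇒n≤o i (≤-pred bnd)
... | ()
thueMorse-overlapFree (suc k) = μ-overlapFree (μ^ k [0]) (thueMorse-overlapFree k)

overlapFree-factor : ∀ p u s → OverlapFree (p ++ u ++ s) → OverlapFree u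
overlapFree-factor p u s of i q 1≤q bnd per = of (length p + i) q 1≤q inside period
  where
  w = p ++ u ++ s
  inside : length p + i + double q < length w
  inside = begin-strict
      length p + i + double q           ≡⟨ +-assoc (length p) i (double q) ⟩
      length p + (i + double q)         <⟨ +-monoʳ-< (length p) bnd ⟩
      length p + length u               ≤⟨ +-monoʳ-≤ (length p) (m≤m+n (length u) (length s)) ⟩
      length p + (length u + length s)  ≡⟨ sym (trans (length-++ p) (cong (length p +_) (length-++ u))) ⟩
      length w ∎
    where open ≤-Reasoning
  within : ∀ j → j + q < suc (double q) → i + j + q < length u
  within j lt = ≤-<-trans (≤-reflexive (+-assoc i j q)) (≤-<-trans (+-monoʳ-≤ i (≤-pred lt)) bnd)
  regroup : ∀ p i j q → p + (i + j + q) ≡ p + i + j + q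
  regroup = solve-∀
  period : HasPeriod w (length p + i) q (suc (double q))
  period j lt = begin
      w ! (length p + i + j)       ≡⟨ cong (w !_) (+-assoc (length p) i j) ⟩
      w ! (length p + (i + j))     ≡⟨ !-factor p u s (i + j) (≤-<-trans (m≤m+n (i + j) q) (within j lt)) ⟩
      u ! (i + j)                  ≡⟨ per j lt ⟩
      u ! (i + j + q)              ≡⟨ sym (!-factor p u s (i + j + q) (within j lt)) ⟩
      w ! (length p + (i + j + q)) ≡⟨ cong (w !_) (regroup (length p) i j q) ⟩
      w ! (length p + i + j + q) ∎
    where open ≡-Reasoning

μ-∷ : ∀ b v → μ (b ∷ v) ≡ b ∷ not b ∷ μ v
μ-∷ false v = refl
μ-∷ true v = refl

μ-++ : ∀ u v → μ (u ++ v) ≡ μ u ++ μ v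
μ-++ u v = trans (cong concat (map-++ μ-letter u v)) (sym (concat-++ (map μ-letter u) (map μ-letter v)))

-- An occurrence of 1001 in μ v is the image of an occurrence of 10 in v
-- (the two 0s cannot form a block b (not b)).
μ-parse-1001 : ∀ v A B → μ v ≡ A ++ w1001 ++ B →
               ∃[ v₁ ] ∃[ v₂ ] (v ≡ v₁ ++ true ∷ false ∷ v₂ × μ v₁ ≡ A × μ v₂ ≡ B)
μ-parse-1001 (true ∷ false ∷ v) [] B refl = [] , v , refl , refl , refl
μ-parse-1001 (b ∷ v) (a ∷ a' ∷ A) B e
  with ∷-injective (trans (sym (μ-∷ b v)) e)
... | refl , e' with μ-parse-1001 v A B (∷-injectiveʳ e')
...   | v₁ , v₂ , refl , refl , μv₂ =
  b ∷ v₁ , v₂ , refl , trans (μ-∷ b v₁) (cong (λ c → b ∷ c ∷ μ v₁) (proj₁ (∷-injective e'))) , μv₂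
μ-parse-1001 [] [] B ()
μ-parse-1001 [] (a ∷ A) B ()
μ-parse-1001 (false ∷ v) [] B ()
μ-parse-1001 (true ∷ []) [] B ()
μ-parse-1001 (true ∷ true ∷ v) [] B ()
μ-parse-1001 (true ∷ v) (a ∷ []) B ()
μ-parse-1001 (false ∷ []) (a ∷ []) B ()
μ-parse-1001 (false ∷ false ∷ v) (a ∷ []) B ()
μ-parse-1001 (false ∷ true ∷ v) (a ∷ []) B ()

μ-prefix : ∀ u w C → μ w ≡ μ u ++ C → ∃[ r ] (w ≡ u ++ r × μ r ≡ C)
μ-prefix [] w C e = w , refl , e
μ-prefix (c ∷ u) [] C e with trans e (cong (_++ C) (μ-∷ c u))
... | ()
μ-prefix (c ∷ u) (b ∷ w) C e with ∷-injective (trans (sym (μ-∷ b w)) (trans e (cong (_++ C) (μ-∷ c u))))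
... | refl , e' with μ-prefix u w C (∷-injectiveʳ e')
...   | r , refl , μr = r , refl , μr

++-reassoc : ∀ (P x z S : Word) → P ++ (x ++ z) ++ S ≡ (P ++ x) ++ z ++ S
++-reassoc P x z S = trans (cong (P ++_) (++-assoc x z S)) (sym (++-assoc P x (z ++ S)))

μ-starts-1001 : ∀ y z → μ y ≡ w1001 ++ z → ∃[ y'' ] (y ≡ true ∷ false ∷ y'')
μ-starts-1001 y z e with μ-parse-1001 y [] z e
... | [] , y'' , starts , _ , _ = y'' , starts
... | (false ∷ _) , _ , _ , () , _
... | (true ∷ _) , _ , _ , () , _

μ-desubstitute : ∀ v x → IsFactor x (μ v) → ∃[ x'' ] (x ≡ w1001 ++ x'') → ∃[ x' ] (x ≡ x' ++ w1001) →
  ∃[ y ] (x ≡ μ y × IsFactor y v ×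
          (∃[ y'' ] y ≡ true ∷ false ∷ y'') × (∃[ y' ] y ≡ y' ++ true ∷ false ∷ []))
μ-desubstitute v x (P , S , occ) (x'' , refl) (x' , ends)
  with μ-parse-1001 v P (x'' ++ S) occ
     | μ-parse-1001 v (P ++ x') S (trans occ (trans (cong (λ z → P ++ z ++ S) ends) (++-reassoc P x' w1001 S)))
... | v₁ , _ , _ , refl , _ | w₁ , w₂ , refl , μw₁ , _ with μ-prefix v₁ w₁ x' μw₁
...   | r , refl , refl = y , image , factor , μ-starts-1001 y x'' (sym image) , (r , refl)
  where
  y : Word
  y = r ++ true ∷ false ∷ []
  image : w1001 ++ x'' ≡ μ y
  image = trans ends (sym (μ-++ r (true ∷ false ∷ [])))
  factor : IsFactor y ((v₁ ++ r) ++ true ∷ false ∷ w₂)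
  factor = v₁ , w₂ , trans (++-assoc v₁ r _) (cong (v₁ ++_) (sym (++-assoc r (true ∷ false ∷ []) w₂)))

-- An occurrence of a cube uuu at position i of w: period |u| on 3|u| letters.
CubeAt : Word → ℕ → ℕ → Set
CubeAt w i p = ∀ j → j < p + p → w ! (i + j) ≡ w ! (i + j + p)

cube-period : ∀ (P u S : Word) → CubeAt (P ++ (u ++ u ++ u) ++ S) (length P) (length u)
cube-period P u S j lt = begin
    w ! (length P + j)                ≡⟨ !-++ʳ P _ j ⟩
    ((u ++ u ++ u) ++ S) ! j          ≡⟨ cong (λ z → z ! j) (trans cubeS (sym (++-assoc u u (u ++ S)))) ⟩
    ((u ++ u) ++ (u ++ S)) ! j        ≡⟨ trans (!-++-prefix (u ++ u) (u ++ S) j uu) (sym (!-++-prefix (u ++ u) S j uu)) ⟩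
    ((u ++ u) ++ S) ! j               ≡⟨ cong (λ z → z ! j) (++-assoc u u S) ⟩
    (u ++ u ++ S) ! j                 ≡⟨ sym (!-++ʳ u (u ++ u ++ S) j) ⟩
    (u ++ u ++ u ++ S) ! (length u + j) ≡⟨ cong (λ z → z ! (length u + j)) (sym cubeS) ⟩
    ((u ++ u ++ u) ++ S) ! (length u + j) ≡⟨ sym (!-++ʳ P _ (length u + j)) ⟩
    w ! (length P + (length u + j))   ≡⟨ cong (w !_) (regroup (length P) (length u) j) ⟩
    w ! (length P + j + length u) ∎
  where
  open ≡-Reasoning
  w = P ++ (u ++ u ++ u) ++ S
  uu : j < length (u ++ u)
  uu = subst (j <_) (sym (length-++ u)) lt
  cubeS : (u ++ u ++ u) ++ S ≡ u ++ u ++ u ++ S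
  cubeS = trans (++-assoc u (u ++ u) S) (cong (u ++_) (++-assoc u u S))
  regroup : ∀ p q j → p + (q + j) ≡ p + j + q
  regroup = solve-∀

cube-fits : ∀ (P u S : Word) → length P + (length u + (length u + length u)) ≤ length (P ++ (u ++ u ++ u) ++ S)
cube-fits P u S = begin
    length P + (length u + (length u + length u))     ≡⟨ cong (λ z → length P + (length u + z)) (sym (length-++ u)) ⟩
    length P + (length u + length (u ++ u))           ≡⟨ cong (length P +_) (sym (length-++ u)) ⟩
    length P + length (u ++ u ++ u)                   ≤⟨ +-monoʳ-≤ (length P) (m≤m+n _ (length S)) ⟩
    length P + (length (u ++ u ++ u) + length S)      ≡⟨ cong (length P +_) (sym (length-++ (u ++ u ++ u))) ⟩
    length P + length ((u ++ u ++ u) ++ S)            ≡⟨ sym (length-++ P) ⟩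
    length (P ++ (u ++ u ++ u) ++ S) ∎
  where open ≤-Reasoning

-- Write H = x 101100, so the word of the theorem is W = H H, read in
-- blocks (letters 2k, 2k+1), T = 2·shift blocks in all:
--   blocks k < m        : the blocks (y!k, not y!k) of μ y           (mixed)
--   block m             : 10                                            (mixed)
--   blocks c1, d1       : 11 and 00                                     (constant)
--   blocks shift + k    : the same pattern again, with sep₂ = shift + m, c2, d2.
module CubeFreeness (y y' y'' : Word) (y-start : y ≡ true ∷ false ∷ y'')
                    (y-end : y ≡ y' ++ true ∷ false ∷ []) (y-overlapFree : OverlapFree y) where

  m' : ℕ
  m' = length y'

  m : ℕ
  m = suc (suc m')

  length-y : length y ≡ m
  length-y = trans (cong length y-end) (trans (length-++ y') (+-comm m' 2))

  y-letter : ∀ k → k < m → ∃[ b ] (y ! k ≡ just b)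
  y-letter k lt = !-valid y k (subst (k <_) (sym length-y) lt)

  y-first : y ! 0 ≡ just true
  y-first = cong (λ z → z ! 0) y-start

  y-second : y ! 1 ≡ just false
  y-second = cong (λ z → z ! 1) y-start

  y-last : y ! suc m' ≡ just false
  y-last = trans (cong (λ z → z ! suc m') y-end)
                 (trans (cong ((y' ++ true ∷ false ∷ []) !_) (+-comm 1 m')) (!-++ʳ y' _ 1))

  x : Word
  x = μ y

  length-x : length x ≡ double m
  length-x = trans (length-μ y) (cong double length-y)

  c1 d1 shift sep₂ c2 d2 T : ℕ
  c1 = suc m
  d1 = suc c1
  shift = suc d1
  sep₂ = shift + m
  c2 = suc sep₂
  d2 = suc c2
  T = suc d2

  H : Word
  H = x ++ w101100

  W : Word
  W = H ++ H

  length-H : length H ≡ double shift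
  length-H = trans (length-++ x) (trans (cong (_+ 6) length-x) (+-comm (double m) 6))

  T≡double-shift : T ≡ double shift
  T≡double-shift = trans (arith m) (sym (double≡+ shift))
    where
    arith : ∀ m → 3 + (3 + m + m) ≡ 3 + m + (3 + m)
    arith = solve-∀

  length-W : length W ≡ double T
  length-W = begin
    length W                    ≡⟨ length-++ H ⟩
    length H + length H         ≡⟨ cong (λ z → z + z) length-H ⟩
    double shift + double shift ≡⟨ sym (double-+ shift shift) ⟩
    double (shift + shift)      ≡⟨ cong double (trans (sym (double≡+ shift)) (sym T≡double-shift)) ⟩
    double T ∎
    where open ≡-Reasoning

  first-half : ∀ j → j < double shift → W ! j ≡ H ! j
  first-half j lt = !-++-prefix H H j (subst (j <_) (sym length-H) lt)

  second-half : ∀ r k → W ! (r + double (shift + k)) ≡ H ! (r + double k)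
  second-half r k = trans (cong (W !_) position) (trans (cong (λ z → W ! (z + (r + double k))) (sym length-H))
                                                          (!-++ʳ H H (r + double k)))
    where
    rearrange : ∀ r a b → r + (a + b) ≡ a + (r + b)
    rearrange = solve-∀
    position : r + double (shift + k) ≡ double shift + (r + double k)
    position = trans (cong (r +_) (double-+ shift k)) (rearrange r (double shift) (double k))

  H-copy-first : ∀ k → k < m → H ! double k ≡ y ! k
  H-copy-first k lt = trans (!-++-prefix x w101100 (double k) inside) (μ-!-even y k)
    where
    inside : double k < length x
    inside = subst (double k <_) (sym length-x) (≤-trans (n≤1+n _) (double-mono-≤ lt))

  H-copy-second : ∀ k → k < m → H ! suc (double k) ≡ Mb.map not (y ! k)
  H-copy-second k lt = trans (!-++-prefix x w101100 (suc (double k)) inside) (μ-!-odd y k)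
    where
    inside : suc (double k) < length x
    inside = subst (suc (double k) <_) (sym length-x) (double-mono-≤ lt)

  H-tail : ∀ j → H ! (j + double m) ≡ w101100 ! j
  H-tail j = trans (cong (H !_) (trans (+-comm j (double m)) (cong (_+ j) (sym length-x)))) (!-++ʳ x w101100 j)

  block-in-first-half : ∀ {k} → k < shift → double k < double shift × suc (double k) < double shift
  block-in-first-half lt = ≤-trans (n≤1+n _) (double-mono-≤ lt) , double-mono-≤ lt

  m<shift : m < shift
  m<shift = s≤s (≤-trans (n≤1+n m) (n≤1+n (suc m)))

  copy₁-first : ∀ k → k < m → W ! double k ≡ y ! k
  copy₁-first k lt = trans (first-half _ (proj₁ (block-in-first-half (<-trans lt m<shift)))) (H-copy-first k lt)

  copy₁-second : ∀ k → k < m → W ! suc (double k) ≡ Mb.map not (y ! k)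
  copy₁-second k lt = trans (first-half _ (proj₂ (block-in-first-half (<-trans lt m<shift)))) (H-copy-second k lt)

  copy₂-first : ∀ k → k < m → W ! double (shift + k) ≡ y ! k
  copy₂-first k lt = trans (second-half 0 k) (H-copy-first k lt)

  copy₂-second : ∀ k → k < m → W ! suc (double (shift + k)) ≡ Mb.map not (y ! k)
  copy₂-second k lt = trans (second-half 1 k) (H-copy-second k lt)

  W-sep₁ : ∀ j → j < 6 → W ! (j + double m) ≡ w101100 ! j
  W-sep₁ j lt = trans (first-half (j + double m) (+-monoˡ-< (double m) lt)) (H-tail j)

  W-sep₂ : ∀ j → W ! (j + double sep₂) ≡ w101100 ! j
  W-sep₂ j = trans (second-half j m) (H-tail j)

  sep₁-first : W ! double m ≡ just true
  sep₁-first = W-sep₁ 0 (s≤s z≤n)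
  sep₁-second : W ! suc (double m) ≡ just false
  sep₁-second = W-sep₁ 1 (s≤s (s≤s z≤n))
  c1-first : W ! double c1 ≡ just true
  c1-first = W-sep₁ 2 (s≤s (s≤s (s≤s z≤n)))
  c1-second : W ! suc (double c1) ≡ just true
  c1-second = W-sep₁ 3 (s≤s (s≤s (s≤s (s≤s z≤n))))
  d1-first : W ! double d1 ≡ just false
  d1-first = W-sep₁ 4 (s≤s (s≤s (s≤s (s≤s (s≤s z≤n)))))
  d1-second : W ! suc (double d1) ≡ just false
  d1-second = W-sep₁ 5 ≤-refl
  sep₂-first : W ! double sep₂ ≡ just true
  sep₂-first = W-sep₂ 0
  sep₂-second : W ! suc (double sep₂) ≡ just false
  sep₂-second = W-sep₂ 1
  c2-first : W ! double c2 ≡ just true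
  c2-first = W-sep₂ 2
  c2-second : W ! suc (double c2) ≡ just true
  c2-second = W-sep₂ 3
  d2-first : W ! double d2 ≡ just false
  d2-first = W-sep₂ 4
  d2-second : W ! suc (double d2) ≡ just false
  d2-second = W-sep₂ 5

  copy₂-start : W ! double shift ≡ just true
  copy₂-start = trans (cong (λ z → W ! double z) (sym (+-identityʳ shift))) (trans (copy₂-first 0 (s≤s z≤n)) y-first)

  data Region (k : ℕ) : Set where
    in-copy₁ : k < m → Region k
    at-sep₁  : k ≡ m → Region k
    at-c1    : k ≡ c1 → Region k
    at-d1    : k ≡ d1 → Region k
    in-copy₂ : ∀ k' → k' < m → k ≡ shift + k' → Region k
    at-sep₂  : k ≡ sep₂ → Region k
    at-c2    : k ≡ c2 → Region k
    at-d2    : k ≡ d2 → Region k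

  half-region : ∀ k → k < shift → k < m ⊎ (k ≡ m ⊎ (k ≡ c1 ⊎ k ≡ d1))
  half-region k lt with below-or-above k m
  ... | inj₁ l = inj₁ l
  ... | inj₂ (0 , refl) = inj₂ (inj₁ (+-identityʳ m))
  ... | inj₂ (1 , refl) = inj₂ (inj₂ (inj₁ (+-comm m 1)))
  ... | inj₂ (2 , refl) = inj₂ (inj₂ (inj₂ (+-comm m 2)))
  ... | inj₂ (suc (suc (suc d)) , refl) =
    ⊥-elim (<⇒≱ lt (≤-trans (≤-reflexive (+-comm 3 m)) (+-monoʳ-≤ m (m≤m+n 3 d))))

  region : ∀ k → k < T → Region k
  region k lt with below-or-above k shift
  region k lt | inj₁ l with half-region k l
  ... | inj₁ l' = in-copy₁ l'
  ... | inj₂ (inj₁ e) = at-sep₁ e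
  ... | inj₂ (inj₂ (inj₁ e)) = at-c1 e
  ... | inj₂ (inj₂ (inj₂ e)) = at-d1 e
  region k lt | inj₂ (k' , refl)
    with half-region k' (+-cancelˡ-< shift k' shift (subst (shift + k' <_) (trans T≡double-shift (double≡+ shift)) lt))
  ... | inj₁ l' = in-copy₂ k' l' refl
  ... | inj₂ (inj₁ refl) = at-sep₂ refl
  ... | inj₂ (inj₂ (inj₁ refl)) = at-c2 (+-suc shift m)
  ... | inj₂ (inj₂ (inj₂ refl)) = at-d2 (trans (+-suc shift c1) (cong suc (+-suc shift m)))

  Mixed : ℕ → Set
  Mixed k = ∃[ b ] (W ! double k ≡ just b × W ! suc (double k) ≡ just (not b))

  Constant : ℕ → Set
  Constant k = W ! double k ≡ W ! suc (double k)

  mixed-not-constant : ∀ {k} → Mixed k → Constant k → ⊥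
  mixed-not-constant (false , e1 , e2) c = true≢false (just-injective (trans (sym e2) (trans (sym c) e1)))
  mixed-not-constant (true , e1 , e2) c = true≢false (just-injective (trans (sym e1) (trans c e2)))

  mixed-second : ∀ {k} → Mixed k → W ! suc (double k) ≡ Mb.map not (W ! double k)
  mixed-second (b , e1 , e2) = trans e2 (cong (Mb.map not) (sym e1))

  copy₁-mixed : ∀ k → k < m → Mixed k
  copy₁-mixed k lt with y-letter k lt
  ... | b , e = b , trans (copy₁-first k lt) e , trans (copy₁-second k lt) (cong (Mb.map not) e)

  copy₂-mixed : ∀ k → k < m → Mixed (shift + k)
  copy₂-mixed k lt with y-letter k lt
  ... | b , e = b , trans (copy₂-first k lt) e , trans (copy₂-second k lt) (cong (Mb.map not) e)

  data ConstantBlock (k : ℕ) : Set where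
    is-c1 : k ≡ c1 → ConstantBlock k
    is-d1 : k ≡ d1 → ConstantBlock k
    is-c2 : k ≡ c2 → ConstantBlock k
    is-d2 : k ≡ d2 → ConstantBlock k

  constantBlock-constant : ∀ {k} → ConstantBlock k → Constant k
  constantBlock-constant (is-c1 refl) = trans c1-first (sym c1-second)
  constantBlock-constant (is-d1 refl) = trans d1-first (sym d1-second)
  constantBlock-constant (is-c2 refl) = trans c2-first (sym c2-second)
  constantBlock-constant (is-d2 refl) = trans d2-first (sym d2-second)

  classify : ∀ k → k < T → Mixed k ⊎ ConstantBlock k
  classify k lt with region k lt
  ... | in-copy₁ l = inj₁ (copy₁-mixed k l)
  ... | at-sep₁ refl = inj₁ (true , sep₁-first , sep₁-second)
  ... | at-c1 e = inj₂ (is-c1 e)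
  ... | at-d1 e = inj₂ (is-d1 e)
  ... | in-copy₂ k' l refl = inj₁ (copy₂-mixed k' l)
  ... | at-sep₂ refl = inj₁ (true , sep₂-first , sep₂-second)
  ... | at-c2 e = inj₂ (is-c2 e)
  ... | at-d2 e = inj₂ (is-d2 e)

  constant-classify : ∀ k → k < T → Constant k → ConstantBlock k
  constant-classify k lt c with classify k lt
  ... | inj₁ mixed = ⊥-elim (mixed-not-constant mixed c)
  ... | inj₂ cb = cb

  c1<c2 : c1 < c2
  c1<c2 = s≤s (≤-trans (n≤1+n c1) (≤-trans (n≤1+n d1) (m≤m+n shift m)))

  d1<d2 : d1 < d2
  d1<d2 = s≤s c1<c2

  moved : ∀ {k k' v} → k' ≡ k → W ! double k ≡ v → W ! double k' ≡ v
  moved refl e = e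

  clash : ∀ {j j'} → W ! j ≡ just true → W ! j' ≡ just false → W ! j ≡ W ! j' → ⊥
  clash t f same = true≢false (just-injective (trans (sym t) (trans same f)))

  constant-pair : ∀ r q → 1 ≤ q → ConstantBlock r → ConstantBlock (r + q) →
                  W ! double r ≡ W ! double (r + q) → q ≡ shift
  constant-pair r q 1≤q (is-c1 refl) (is-c2 e) _ = +-cancelˡ-≡ c1 q shift (trans e (sym (trans (+-comm c1 shift) (+-suc shift m))))
  constant-pair r q 1≤q (is-d1 refl) (is-d2 e) _ =
    +-cancelˡ-≡ d1 q shift (trans e (sym (trans (+-comm d1 shift) (trans (+-suc shift c1) (cong suc (+-suc shift m))))))
  constant-pair r (suc q) _ (is-c1 refl) (is-c1 e) _ = ⊥-elim (m+1+n≢m c1 e)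
  constant-pair r (suc q) _ (is-d1 refl) (is-d1 e) _ = ⊥-elim (m+1+n≢m d1 e)
  constant-pair r (suc q) _ (is-c2 refl) (is-c2 e) _ = ⊥-elim (m+1+n≢m c2 e)
  constant-pair r (suc q) _ (is-d2 refl) (is-d2 e) _ = ⊥-elim (m+1+n≢m d2 e)
  constant-pair r q 1≤q (is-c2 refl) (is-c1 e) _ = ⊥-elim (<⇒≱ c1<c2 (≤-trans (m≤m+n c2 q) (≤-reflexive e)))
  constant-pair r q 1≤q (is-d2 refl) (is-d1 e) _ = ⊥-elim (<⇒≱ d1<d2 (≤-trans (m≤m+n d2 q) (≤-reflexive e)))
  constant-pair r q 1≤q (is-c1 refl) (is-d1 e) same = ⊥-elim (clash c1-first (moved e d1-first) same)
  constant-pair r q 1≤q (is-c1 refl) (is-d2 e) same = ⊥-elim (clash c1-first (moved e d2-first) same)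
  constant-pair r q 1≤q (is-c2 refl) (is-d1 e) same = ⊥-elim (clash c2-first (moved e d1-first) same)
  constant-pair r q 1≤q (is-c2 refl) (is-d2 e) same = ⊥-elim (clash c2-first (moved e d2-first) same)
  constant-pair r q 1≤q (is-d1 refl) (is-c1 e) same = ⊥-elim (clash (moved e c1-first) d1-first (sym same))
  constant-pair r q 1≤q (is-d1 refl) (is-c2 e) same = ⊥-elim (clash (moved e c2-first) d1-first (sym same))
  constant-pair r q 1≤q (is-d2 refl) (is-c1 e) same = ⊥-elim (clash (moved e c1-first) d2-first (sym same))
  constant-pair r q 1≤q (is-d2 refl) (is-c2 e) same = ⊥-elim (clash (moved e c2-first) d2-first (sym same))

  -- Odd periods. oddBefore k: an odd number of constant blocks precedes block k.
  -- Constant blocks come in adjacent pairs (c, d), so this holds exactly at d1 and d2.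
  oddBefore : ℕ → Bool
  oddBefore k = does (k ≟ d1) xor does (k ≟ d2)

  oddBefore-false : ∀ k → k ≢ d1 → k ≢ d2 → oddBefore k ≡ false
  oddBefore-false k n1 n2 rewrite dec-false (k ≟ d1) n1 | dec-false (k ≟ d2) n2 = refl

  oddBefore-d1 : oddBefore d1 ≡ true
  oddBefore-d1 rewrite dec-true (d1 ≟ d1) refl | dec-false (d1 ≟ d2) (<⇒≢ d1<d2) = refl

  oddBefore-d2 : oddBefore d2 ≡ true
  oddBefore-d2 rewrite dec-false (d2 ≟ d1) (≢-sym (<⇒≢ d1<d2)) | dec-true (d2 ≟ d2) refl = refl

  before-d1 : ∀ k → k ≤ c1 → oddBefore k ≡ false
  before-d1 k le = oddBefore-false k (<⇒≢ (s≤s le)) (<⇒≢ (<-trans (s≤s le) d1<d2))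

  between-d1-d2 : ∀ k → d1 < k → k ≤ c2 → oddBefore k ≡ false
  between-d1-d2 k lt le = oddBefore-false k (≢-sym (<⇒≢ lt)) (<⇒≢ (s≤s le))

  oddBefore-true : ∀ k → oddBefore k ≡ true → k ≡ d1 ⊎ k ≡ d2
  oddBefore-true k e with k ≟ d1 | k ≟ d2
  ... | yes k≡d1 | _ = inj₁ k≡d1
  ... | no _ | yes k≡d2 = inj₂ k≡d2
  ... | no k≢d1 | no k≢d2 = ⊥-elim (true≢false (trans (sym e) (oddBefore-false k k≢d1 k≢d2)))

  5≤shift : 5 ≤ shift
  5≤shift = s≤s (s≤s (s≤s (s≤s (s≤s z≤n))))

  oddBefore-spaced : ∀ k d → oddBefore k ≡ true → oddBefore (k + d) ≡ true → d ≡ 0 ⊎ d ≡ shift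
  oddBefore-spaced k d t t' with oddBefore-true k t | oddBefore-true (k + d) t'
  ... | inj₁ refl | inj₁ e = inj₁ (+-cancelˡ-≡ d1 d 0 (trans e (sym (+-identityʳ d1))))
  ... | inj₁ refl | inj₂ e = inj₂ (+-cancelˡ-≡ d1 d shift (trans e (sym d1+shift)))
    where
    d1+shift : d1 + shift ≡ d2
    d1+shift = trans (+-comm d1 shift) (trans (+-suc shift c1) (cong suc (+-suc shift m)))
  ... | inj₂ refl | inj₁ e = ⊥-elim (<⇒≱ d1<d2 (≤-trans (m≤m+n d2 d) (≤-reflexive e)))
  ... | inj₂ refl | inj₂ e = inj₁ (+-cancelˡ-≡ d2 d 0 (trans e (sym (+-identityʳ d2))))

  blockBit : ℕ → Bool
  blockBit k = bit (W ! double k) xor bit (W ! suc (double k))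

  mixed-blockBit : ∀ {k} → Mixed k → blockBit k ≡ true
  mixed-blockBit (b , e1 , e2) rewrite e1 | e2 = xor-not b

  constant-blockBit : ∀ {k} → ConstantBlock k → blockBit k ≡ false
  constant-blockBit {k} cb = trans (cong (λ z → bit z xor bit (W ! suc (double k))) (constantBlock-constant cb))
                                    (xor-same (bit (W ! suc (double k))))

  mixed-step : ∀ {k} → Mixed k → oddBefore k ≡ false → oddBefore (suc k) ≡ false →
               blockBit k ≡ not (oddBefore k xor oddBefore (suc k))
  mixed-step mixed e e' rewrite e | e' = mixed-blockBit mixed

  constant-step : ∀ {k b} → ConstantBlock k → oddBefore k ≡ b → oddBefore (suc k) ≡ not b →
                  blockBit k ≡ not (oddBefore k xor oddBefore (suc k))
  constant-step {b = b} cb e e' rewrite e | e' = trans (constant-blockBit cb) (cong not (sym (xor-not b)))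

  blockBit-oddBefore : ∀ k → k < T → blockBit k ≡ not (oddBefore k xor oddBefore (suc k))
  blockBit-oddBefore k lt with region k lt
  ... | in-copy₁ l = mixed-step (copy₁-mixed k l)
          (before-d1 k (<⇒≤ (<-trans l ≤-refl))) (before-d1 (suc k) (s≤s (<⇒≤ l)))
  ... | at-sep₁ refl = mixed-step (true , sep₁-first , sep₁-second) (before-d1 m (n≤1+n m)) (before-d1 c1 ≤-refl)
  ... | at-c1 refl = constant-step (is-c1 refl) (before-d1 c1 ≤-refl) oddBefore-d1
  ... | at-d1 refl = constant-step (is-d1 refl) oddBefore-d1
          (between-d1-d2 shift ≤-refl (≤-trans (m≤m+n shift m) (n≤1+n sep₂)))
  ... | in-copy₂ k' l refl = mixed-step (copy₂-mixed k' l)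
          (between-d1-d2 (shift + k') (m≤m+n shift k') (≤-trans (+-monoʳ-≤ shift (<⇒≤ l)) (n≤1+n sep₂)))
          (between-d1-d2 (suc (shift + k')) (≤-trans (m≤m+n shift k') (n≤1+n _)) (s≤s (+-monoʳ-≤ shift (<⇒≤ l))))
  ... | at-sep₂ refl = mixed-step (true , sep₂-first , sep₂-second)
          (between-d1-d2 sep₂ (m≤m+n shift m) (n≤1+n sep₂)) (between-d1-d2 c2 (≤-trans (m≤m+n shift m) (n≤1+n sep₂)) ≤-refl)
  ... | at-c2 refl = constant-step (is-c2 refl)
          (between-d1-d2 c2 (≤-trans (m≤m+n shift m) (n≤1+n sep₂)) ≤-refl) oddBefore-d2
  ... | at-d2 refl = constant-step (is-d2 refl) oddBefore-d2
          (oddBefore-false T (≢-sym (<⇒≢ (<-trans d1<d2 ≤-refl))) (≢-sym (<⇒≢ ≤-refl)))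

  blockXor-W : ∀ a r → a + r ≤ T → blockXor W a r ≡ isOdd r xor (oddBefore a xor oddBefore (a + r))
  blockXor-W a zero _ rewrite +-identityʳ a = sym (xor-same (oddBefore a))
  blockXor-W a (suc r) le = begin
      blockBit a xor blockXor W (suc a) r
        ≡⟨ cong₂ _xor_ (blockBit-oddBefore a (<-≤-trans (m<m+n a (s≤s z≤n)) le)) (blockXor-W (suc a) r le') ⟩
      not (oddBefore a xor oddBefore (suc a)) xor (isOdd r xor (oddBefore (suc a) xor oddBefore (suc (a + r))))
        ≡⟨ cong (λ z → not (oddBefore a xor oddBefore (suc a)) xor (isOdd r xor (oddBefore (suc a) xor oddBefore z)))
                (sym (+-suc a r)) ⟩
      not (oddBefore a xor oddBefore (suc a)) xor (isOdd r xor (oddBefore (suc a) xor oddBefore (a + suc r)))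
        ≡⟨ xor-telescope (oddBefore a) (oddBefore (suc a)) (isOdd r) (oddBefore (a + suc r)) ⟩
      not (isOdd r) xor (oddBefore a xor oddBefore (a + suc r)) ∎
    where
    open ≡-Reasoning
    le' : suc a + r ≤ T
    le' = subst (_≤ T) (+-suc a r) le

  block-square-fits : ∀ i p a' d → i + (p + (p + p)) ≤ double T → double a' ≡ i + d → d ≤ p → a' + p ≤ T
  block-square-fits i p a' d bnd e2a d≤p = double-cancel-≤ (a' + p) T (begin
      double (a' + p)         ≡⟨ trans (double-+ a' p) (cong₂ _+_ e2a (double≡+ p)) ⟩
      i + d + (p + p)         ≡⟨ +-assoc i d (p + p) ⟩
      i + (d + (p + p))       ≤⟨ +-monoʳ-≤ i (+-monoˡ-≤ (p + p) d≤p) ⟩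
      i + (p + (p + p))       ≤⟨ bnd ⟩
      double T ∎)
    where open ≤-Reasoning

  cube-separates : ∀ i p → CubeAt W i p → i + (p + (p + p)) ≤ double T → isOdd p ≡ true →
                   ∀ a' d → double a' ≡ i + d → d ≤ p → Separates oddBefore p a'
  cube-separates i p cube bnd odd a' d e2a d≤p = not-injective (begin
      not (oddBefore a' xor oddBefore (a' + p))          ≡⟨ cong (_xor (oddBefore a' xor oddBefore (a' + p))) (sym odd) ⟩
      isOdd p xor (oddBefore a' xor oddBefore (a' + p))
        ≡⟨ sym (blockXor-W a' p (block-square-fits i p a' d bnd e2a d≤p)) ⟩
      blockXor W a' p
        ≡⟨ square-blockXor W i d a' p e2a (λ t lt → cube (d + t) (+-mono-≤-< d≤p lt)) ⟩
      false ∎)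
    where
    open ≡-Reasoning

  -- No cube of odd period p ≥ 3: the squares starting at the first two (three, if p ≥ 5)
  -- block boundaries inside the cube would all be separated by oddBefore.
  no-oddCube : ∀ i h → CubeAt W i (suc (double (suc h))) →
               i + (suc (double (suc h)) + (suc (double (suc h)) + suc (double (suc h)))) ≤ double T → ⊥
  no-oddCube i h cube bnd with next-even i
  ... | a , δ , e , δ≤1 =
        Spaced.no-separation oddBefore shift 5≤shift oddBefore-spaced a p (s≤s (s≤s (s≤s z≤n)))
          (separates a δ e (≤-trans δ≤1 (s≤s z≤n)))
          (separates (suc a) (δ + 2) (trans (cong (λ z → suc (suc z)) e) (sym (shift-by i δ 2)))
                     (≤-trans (+-monoˡ-≤ 2 δ≤1) (s≤s (s≤s (s≤s z≤n)))))
          (λ 4≤p → separates (suc (suc a)) (δ + 4) (trans (cong (λ z → suc (suc (suc (suc z)))) e) (sym (shift-by i δ 4)))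
                     (≤-trans (+-monoˡ-≤ 4 δ≤1) (odd-4≤⇒5≤ h 4≤p)))
    where
    p : ℕ
    p = suc (double (suc h))
    separates : ∀ a' d → double a' ≡ i + d → d ≤ p → Separates oddBefore p a'
    separates = cube-separates i p cube bnd (isOdd-odd (suc h))
    shift-by : ∀ i δ n → i + (δ + n) ≡ n + (i + δ)
    shift-by = solve-∀

  letters-1 : ∀ i → CubeAt W i 1 → W ! i ≡ W ! suc i × W ! suc i ≡ W ! suc (suc i)
  letters-1 i cube =
    trans (cong (W !_) (sym (+-identityʳ i))) (trans (cube 0 (s≤s z≤n)) (cong (W !_) (trans (cong (_+ 1) (+-identityʳ i)) (+-comm i 1)))) ,
    trans (cong (W !_) (+-comm 1 i)) (trans (cube 1 (s≤s (s≤s z≤n))) (cong (W !_) (two-more i)))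
    where
    two-more : ∀ i → i + 1 + 1 ≡ suc (suc i)
    two-more = solve-∀

  -- No cube bbb: the constant block inside it would be followed or preceded by a
  -- block starting with the same letter, which the layout excludes.
  no-cube-period1 : ∀ i → CubeAt W i 1 → i + (1 + (1 + 1)) ≤ double T → ⊥
  no-cube-period1 i cube bnd with even-or-odd i
  ... | inj₁ (a , refl) with classify a (double-cancel-< a T (≤-trans (s≤s (≤-trans (n≤1+n _) (n≤1+n _)))
                                                                 (≤-trans (≤-reflexive (+-comm 3 (double a))) bnd)))
  ...   | inj₁ mixed = mixed-not-constant mixed (proj₁ (letters-1 (double a) cube))
  ...   | inj₂ (is-c1 refl) = clash c1-second d1-first (proj₂ (letters-1 (double c1) cube))
  ...   | inj₂ (is-d1 refl) = clash copy₂-start d1-second (sym (proj₂ (letters-1 (double d1) cube)))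
  ...   | inj₂ (is-c2 refl) = clash c2-second d2-first (proj₂ (letters-1 (double c2) cube))
  ...   | inj₂ (is-d2 refl) = 1+n≰n (≤-pred (≤-pred (subst (_≤ double T) (+-comm (double d2) 3) bnd)))
  no-cube-period1 i cube bnd | inj₂ (c , refl) with classify (suc c) (double-cancel-< (suc c) T
                                                    (≤-trans (n≤1+n _) (≤-trans (≤-reflexive (+-comm 3 (suc (double c)))) bnd)))
  ... | inj₁ mixed = mixed-not-constant mixed (proj₂ (letters-1 (suc (double c)) cube))
  ... | inj₂ (is-c1 refl) = clash c1-first sep₁-second (sym (proj₁ (letters-1 (suc (double m)) cube)))
  ... | inj₂ (is-d1 refl) = clash c1-second d1-first (proj₁ (letters-1 (suc (double c1)) cube))
  ... | inj₂ (is-c2 refl) = clash c2-first sep₂-second (sym (proj₁ (letters-1 (suc (double sep₂)) cube)))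
  ... | inj₂ (is-d2 refl) = clash c2-second d2-first (proj₁ (letters-1 (suc (double c2)) cube))

  -- Even periods. A cube of period 2q read blockwise: the first (second) letters of
  -- the blocks of a range [a, a + L) have period q.
  FirstPeriod SecondPeriod BlockPeriod : ℕ → ℕ → ℕ → Set
  FirstPeriod a q L = ∀ j → j + q < L → W ! double (a + j) ≡ W ! double (a + j + q)
  SecondPeriod a q L = ∀ j → j + q < L → W ! suc (double (a + j)) ≡ W ! suc (double (a + j + q))
  BlockPeriod a q L = FirstPeriod a q L × SecondPeriod a q L

  periodic-constant : ∀ r q → 1 ≤ q → r + q < T → W ! double r ≡ W ! double (r + q) →
                      W ! suc (double r) ≡ W ! suc (double (r + q)) → Constant r ⊎ Constant (r + q) → q ≡ shift
  periodic-constant r q 1≤q lt e₁ e₂ (inj₁ cr) =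
    constant-pair r q 1≤q (constant-classify r (≤-<-trans (m≤m+n r q) lt) cr)
                          (constant-classify (r + q) lt (trans (sym e₁) (trans cr e₂))) e₁
  periodic-constant r q 1≤q lt e₁ e₂ (inj₂ cr') =
    constant-pair r q 1≤q (constant-classify r (≤-<-trans (m≤m+n r q) lt) (trans e₁ (trans cr' (sym e₂))))
                          (constant-classify (r + q) lt cr') e₁

  -- In a blockwise periodic range of length L ≥ 2q every block is mixed (when q ≠ shift):
  -- each block has a partner at distance q inside the range.
  blockPeriod-mixed : ∀ a q L → 1 ≤ q → q ≢ shift → double q ≤ L → a + L ≤ T → BlockPeriod a q L →
                      ∀ j → j < L → Mixed (a + j)
  blockPeriod-mixed a q L 1≤q q≢shift 2q≤L aL (first , second) j jL with classify (a + j) (<-≤-trans (+-monoʳ-< a jL) aL)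
  ... | inj₁ mixed = mixed
  ... | inj₂ cb with j + q <? L
  ...   | yes l = ⊥-elim (q≢shift (periodic-constant (a + j) q 1≤q (inside l) (first j l) (second j l) (inj₁ (constantBlock-constant cb))))
    where
    inside : ∀ {j} → j + q < L → a + j + q < T
    inside l = <-≤-trans (subst (_< a + L) (sym (+-assoc a _ q)) (+-monoʳ-< a l)) aL
  ...   | no nl = ⊥-elim (q≢shift (periodic-constant (a + j') q 1≤q (subst (_< T) a+j≡ (<-≤-trans (+-monoʳ-< a jL) aL))
                     (first j' l') (second j' l') (inj₂ (subst Constant a+j≡ (constantBlock-constant cb)))))
    where
    q≤j : q ≤ j
    q≤j = +-cancelʳ-≤ q q j (≤-trans (≤-reflexive (sym (double≡+ q))) (≤-trans 2q≤L (≮⇒≥ nl)))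
    j' : ℕ
    j' = j ∸ q
    j'+q : j' + q ≡ j
    j'+q = m∸n+n≡m q≤j
    a+j≡ : a + j ≡ a + j' + q
    a+j≡ = trans (cong (a +_) (sym j'+q)) (sym (+-assoc a j' q))
    l' : j' + q < L
    l' = subst (_< L) (sym j'+q) jL

  long-period-not-shift : ∀ a q L → double q < L → a + L ≤ T → q ≢ shift
  long-period-not-shift a q L qL aL refl = <⇒≱ qL (≤-trans (m≤n+m L a) (≤-trans aL (≤-reflexive T≡double-shift)))

  mixed-avoids : ∀ a L → (∀ j → j < L → Mixed (a + j)) → ∀ b → ConstantBlock b → a ≤ b → b < a + L → ⊥
  mixed-avoids a L mixed b cb a≤b b<a+L = mixed-not-constant (subst Mixed a+[b∸a] (mixed (b ∸ a) inside)) (constantBlock-constant cb)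
    where
    a+[b∸a] : a + (b ∸ a) ≡ b
    a+[b∸a] = m+[n∸m]≡n a≤b
    inside : b ∸ a < L
    inside = +-cancelˡ-< a (b ∸ a) L (subst (_< a + L) (sym a+[b∸a]) b<a+L)

  mixed-range : ∀ a L → 1 ≤ L → a + L ≤ T → (∀ j → j < L → Mixed (a + j)) →
                a + L ≤ c1 ⊎ ∃[ a' ] (a ≡ shift + a' × a' + L ≤ c1)
  mixed-range a L 1≤L aT mixed with a + L ≤? c1
  ... | yes r = inj₁ r
  ... | no n1 with a ≤? c1
  ...   | yes r = ⊥-elim (mixed-avoids a L mixed c1 (is-c1 refl) r (≰⇒> n1))
  ...   | no n2 with a ≤? d1
  ...     | yes r = ⊥-elim (mixed-avoids a L mixed d1 (is-d1 refl) r (≤-<-trans (≰⇒> n2) (m<m+n a 1≤L)))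
  ...     | no n3 with (a ∸ shift) + L ≤? c1
  ...       | yes r = inj₂ (a ∸ shift , sym (m+[n∸m]≡n (≰⇒> n3)) , r)
  ...       | no n4 with a ≤? c2
  ...         | yes r = ⊥-elim (mixed-avoids a L mixed c2 (is-c2 refl) r
                      (subst₂ _<_ (+-suc shift m) (trans (sym (+-assoc shift (a ∸ shift) L)) (cong (_+ L) (m+[n∸m]≡n (≰⇒> n3))))
                              (+-monoʳ-< shift (≰⇒> n4))))
  ...         | no n5 = ⊥-elim (mixed-avoids a L mixed d2 (is-d2 refl) (≤-pred (≤-trans (m<m+n a 1≤L) aT))
                                 (≤-<-trans (≰⇒> n5) (m<m+n a 1≤L)))

  -- The first letters of the blocks of either half spell y⁺ = y 1 (the 1 of the separator 10).
  y⁺ : Word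
  y⁺ = y ++ true ∷ []

  y⁺-copy : ∀ k → k < m → y⁺ ! k ≡ y ! k
  y⁺-copy k lt = !-++-prefix y _ k (subst (k <_) (sym length-y) lt)

  y⁺-end : y⁺ ! m ≡ just true
  y⁺-end = trans (cong (y⁺ !_) (trans (sym (+-identityʳ m)) (cong (_+ 0) (sym length-y)))) (!-++ʳ y _ 0)

  half-first-letters : ∀ o → (∀ k → k < m → W ! double (o + k) ≡ y ! k) → W ! double (o + m) ≡ just true →
                       ∀ k → k < c1 → W ! double (o + k) ≡ y⁺ ! k
  half-first-letters o copy sep k lt with m≤n⇒m<n∨m≡n (≤-pred lt)
  ... | inj₁ k<m = trans (copy k k<m) (sym (y⁺-copy k k<m))
  ... | inj₂ refl = trans sep (sym y⁺-end)

  PeriodCondition : ℕ → ℕ → Set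
  PeriodCondition q L = (q ≡ 1 × double q < L) ⊎ suc (double q) < L

  condition-long : ∀ {q L} → PeriodCondition q L → double q < L
  condition-long (inj₁ (_ , l)) = l
  condition-long (inj₂ l) = <-trans (n<1+n _) l

  -- y 1 has no factor of length L with period q ≥ 1 satisfying the period condition:
  -- inside y it would contain an overlap, and for q = 1 the factor cannot end with 0 1.
  y⁺-no-period : ∀ a q L → 1 ≤ q → a + L ≤ c1 → PeriodCondition q L → HasPeriod y⁺ a q L → ⊥
  y⁺-no-period a q L 1≤q aL cond per with a + double q <? m
  ... | yes inside = y-overlapFree a q 1≤q (subst (a + double q <_) (sym length-y) inside) in-y
    where
    in-y : HasPeriod y a q (suc (double q))
    in-y j l = trans (sym (y⁺-copy (a + j) lj)) (trans (per j (≤-<-trans (≤-pred l) (condition-long cond))) (y⁺-copy (a + j + q) ljq))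
      where
      ljq : a + j + q < m
      ljq = ≤-<-trans (≤-reflexive (+-assoc a j q)) (≤-<-trans (+-monoʳ-≤ a (≤-pred l)) inside)
      lj : a + j < m
      lj = ≤-<-trans (m≤m+n _ q) ljq
  ... | no outside with cond
  ...   | inj₂ l = outside (≤-pred (≤-trans (≤-reflexive (sym (two-more a (double q)))) (≤-trans (+-monoʳ-≤ a l) aL)))
    where
    two-more : ∀ a x → a + suc (suc x) ≡ suc (suc (a + x))
    two-more = solve-∀
  ...   | inj₁ (refl , l) = true≢false (just-injective (begin
      just true               ≡⟨ sym y⁺-end ⟩
      y⁺ ! m                  ≡⟨ cong (y⁺ !_) (sym a+2≡m) ⟩
      y⁺ ! (a + 1 + 1)        ≡⟨ sym (per 1 l) ⟩
      y⁺ ! (a + 1)            ≡⟨ cong (y⁺ !_) (suc-injective (trans (sym (+-comm (a + 1) 1)) a+2≡m)) ⟩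
      y⁺ ! suc m'             ≡⟨ trans (y⁺-copy (suc m') ≤-refl) y-last ⟩
      just false ∎))
    where
    open ≡-Reasoning
    plus-two : ∀ a → a + 1 + 1 ≡ a + 2
    plus-two = solve-∀
    a+2≡m : a + 1 + 1 ≡ m
    a+2≡m = trans (plus-two a) (≤-antisym (≤-pred a+3≤m+1) (≮⇒≥ outside))
      where
      a+3≤m+1 : suc (a + 2) ≤ suc m
      a+3≤m+1 = ≤-trans (≤-reflexive (sym (+-suc a 2))) (≤-trans (+-monoʳ-≤ a l) aL)

  in-half : ∀ o q L → (∀ k → k < m → W ! double (o + k) ≡ y ! k) → W ! double (o + m) ≡ just true →
            ∀ a' → a' + L ≤ c1 → FirstPeriod (o + a') q L → HasPeriod y⁺ a' q L
  in-half o q L copy sep a' r first j l = begin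
      y⁺ ! (a' + j)                ≡⟨ sym (half-first-letters o copy sep (a' + j) j-in) ⟩
      W ! double (o + (a' + j))    ≡⟨ cong (λ z → W ! double z) (sym (+-assoc o a' j)) ⟩
      W ! double (o + a' + j)      ≡⟨ first j l ⟩
      W ! double (o + a' + j + q)  ≡⟨ cong (λ z → W ! double z) (trans (cong (_+ q) (+-assoc o a' j)) (+-assoc o (a' + j) q)) ⟩
      W ! double (o + (a' + j + q)) ≡⟨ half-first-letters o copy sep (a' + j + q) jq-in ⟩
      y⁺ ! (a' + j + q) ∎
    where
    open ≡-Reasoning
    jq-in : a' + j + q < c1
    jq-in = <-≤-trans (subst (_< a' + L) (sym (+-assoc a' j q)) (+-monoʳ-< a' l)) r
    j-in : a' + j < c1
    j-in = ≤-<-trans (m≤m+n (a' + j) q) jq-in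

  no-blockPeriod : ∀ a q L → 1 ≤ q → PeriodCondition q L → a + L ≤ T →
                   FirstPeriod a q L → (∀ j → j < L → Mixed (a + j)) → ⊥
  no-blockPeriod a q L 1≤q cond aT first mixed with mixed-range a L (≤-trans (s≤s z≤n) (condition-long cond)) aT mixed
  ... | inj₁ r = y⁺-no-period a q L 1≤q r cond (in-half 0 q L copy₁-first sep₁-first a r first)
  ... | inj₂ (a' , refl , r) = y⁺-no-period a' q L 1≤q r cond (in-half shift q L copy₂-first sep₂-first a' r first)

  cube-letter : ∀ i p → CubeAt W i p → ∀ k → i ≤ k → k < i + (p + p) → W ! k ≡ W ! (k + p)
  cube-letter i p cube k lo hi = trans (cong (W !_) (sym i+[k∸i])) (trans (cube (k ∸ i) inside) (cong (λ z → W ! (z + p)) i+[k∸i]))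
    where
    i+[k∸i] : i + (k ∸ i) ≡ k
    i+[k∸i] = m+[n∸m]≡n lo
    inside : k ∸ i < p + p
    inside = +-cancelˡ-< i (k ∸ i) (p + p) (subst (_< i + (p + p)) (sym i+[k∸i]) hi)

  cube-block-letter : ∀ i q → CubeAt W i (double q) → ∀ r b → i ≤ r + double b →
                      r + double b < i + (double q + double q) → W ! (r + double b) ≡ W ! (r + double (b + q))
  cube-block-letter i q cube r b lo hi = trans (cube-letter i (double q) cube (r + double b) lo hi)
    (cong (W !_) (trans (+-assoc r (double b) (double q)) (cong (r +_) (sym (double-+ b q)))))

  within-two-periods : ∀ a q j r → r ≤ 1 → j < double q → r + double (a + j) < double a + (double q + double q)
  within-two-periods a q j r r≤1 j<2q = begin-strict
      r + double (a + j)            ≤⟨ +-monoˡ-≤ (double (a + j)) r≤1 ⟩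
      suc (double (a + j))          ≡⟨ cong suc (double-+ a j) ⟩
      suc (double a + double j)     ≡⟨ sym (+-suc (double a) (double j)) ⟩
      double a + suc (double j)     <⟨ +-monoʳ-< (double a) (double-mono-≤ j<2q) ⟩
      double a + double (double q)  ≡⟨ cong (double a +_) (double≡+ (double q)) ⟩
      double a + (double q + double q) ∎
    where open ≤-Reasoning

  three-periods-fit : ∀ a q → double a + (double q + (double q + double q)) ≤ double T → a + (double q + q) ≤ T
  three-periods-fit a q bnd = double-cancel-≤ (a + (double q + q)) T (≤-trans (≤-reflexive (begin
      double (a + (double q + q))                    ≡⟨ double≡+ _ ⟩
      (a + (double q + q)) + (a + (double q + q))    ≡⟨ cong (λ z → (a + (z + q)) + (a + (z + q))) (double≡+ q) ⟩
      (a + ((q + q) + q)) + (a + ((q + q) + q))      ≡⟨ regroup a q ⟩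
      (a + a) + ((q + q) + ((q + q) + (q + q)))      ≡⟨ sym (cong₂ (λ u v → u + (v + (v + v))) (double≡+ a) (double≡+ q)) ⟩
      double a + (double q + (double q + double q)) ∎)) bnd)
    where
    open ≡-Reasoning
    regroup : ∀ a q → (a + ((q + q) + q)) + (a + ((q + q) + q)) ≡ (a + a) + ((q + q) + ((q + q) + (q + q)))
    regroup = solve-∀

  three-periods-condition : ∀ q → 1 ≤ q → PeriodCondition q (double q + q)
  three-periods-condition (suc zero) _ = inj₁ (refl , ≤-refl)
  three-periods-condition (suc (suc q)) _ =
    inj₂ (≤-trans (≤-reflexive (+-comm 2 (double (suc (suc q))))) (+-monoʳ-≤ (double (suc (suc q))) (s≤s (s≤s z≤n))))

  -- Even period 2q from an even position 2a: the 3q blocks from a are periodic, hence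
  -- mixed, and their first letters contradict the period condition.
  no-evenCube-evenStart : ∀ a q → 1 ≤ q → CubeAt W (double a) (double q) →
                          double a + (double q + (double q + double q)) ≤ double T → ⊥
  no-evenCube-evenStart a q 1≤q cube bnd =
    no-blockPeriod a q (double q + q) 1≤q (three-periods-condition q 1≤q) fits (proj₁ period)
      (blockPeriod-mixed a q (double q + q) 1≤q (long-period-not-shift a q (double q + q) (m<m+n (double q) 1≤q) fits)
                         (m≤m+n (double q) q) fits period)
    where
    fits : a + (double q + q) ≤ T
    fits = three-periods-fit a q bnd
    lo : ∀ r j → double a ≤ r + double (a + j)
    lo r j = ≤-trans (double-mono-≤ (m≤m+n a j)) (m≤n+m _ r)
    period : BlockPeriod a q (double q + q)
    period = (λ j l → cube-block-letter (double a) q cube 0 (a + j) (lo 0 j)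
                        (within-two-periods a q j 0 z≤n (+-cancelʳ-< q j (double q) l)))
           , (λ j l → cube-block-letter (double a) q cube 1 (a + j) (lo 1 j)
                        (within-two-periods a q j 1 (s≤s z≤n) (+-cancelʳ-< q j (double q) l)))

  constant-before-mixed : ∀ c → ConstantBlock c → Mixed (suc c) → suc c < T → c ≡ d1
  constant-before-mixed c (is-c1 refl) mixed _ = ⊥-elim (mixed-not-constant mixed (constantBlock-constant (is-d1 refl)))
  constant-before-mixed c (is-d1 refl) _ _ = refl
  constant-before-mixed c (is-c2 refl) mixed _ = ⊥-elim (mixed-not-constant mixed (constantBlock-constant (is-d2 refl)))
  constant-before-mixed c (is-d2 refl) _ lt = ⊥-elim (<-irrefl refl lt)

  module OddStart (c q₁ : ℕ) (cube : CubeAt W (suc (double c)) (double (suc q₁)))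
                  (bnd : suc (double c) + (double (suc q₁) + (double (suc q₁) + double (suc q₁))) ≤ double T) where

    q : ℕ
    q = suc q₁

    fits : c + (double q + q) ≤ T
    fits = three-periods-fit c q (≤-trans (n≤1+n _) bnd)

    first : FirstPeriod (suc c) q (double q + q)
    first j l = cube-block-letter (suc (double c)) q cube 0 (suc c + j)
      (s≤s (≤-trans (double-mono-≤ (m≤m+n c j)) (n≤1+n _)))
      (s≤s (within-two-periods c q j 1 (s≤s z≤n) (+-cancelʳ-< q j (double q) l)))

    second : SecondPeriod c q (double q + q)
    second j l = cube-block-letter (suc (double c)) q cube 1 (c + j)
      (s≤s (double-mono-≤ (m≤m+n c j)))
      (s≤s (within-two-periods c q j 0 z≤n (+-cancelʳ-< q j (double q) l)))

    inner : BlockPeriod (suc c) q (double q + q₁)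
    inner = (λ j l → first j (≤-trans l (+-monoʳ-≤ (double q) (n≤1+n q₁))))
          , (λ j l → trans (cong (λ z → W ! suc (double z)) (sym (+-suc c j)))
                       (trans (second (suc j) (≤-trans (s≤s l) (≤-reflexive (sym (+-suc (double q) q₁)))))
                              (cong (λ z → W ! suc (double (z + q))) (+-suc c j))))

    inner-fits : suc c + (double q + q₁) ≤ T
    inner-fits = subst (_≤ T) (trans (cong (c +_) (+-suc (double q) q₁)) (+-suc c (double q + q₁))) fits

    inner-mixed : ∀ j → j < double q + q₁ → Mixed (suc c + j)
    inner-mixed = blockPeriod-mixed (suc c) q (double q + q₁) (s≤s z≤n)
                    (long-period-not-shift c q (double q + q) (m<m+n (double q) (s≤s z≤n)) fits)
                    (m≤m+n (double q) q₁) inner-fits inner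

    inner-start : Mixed (suc c)
    inner-start = subst Mixed (+-identityʳ (suc c)) (inner-mixed 0 (s≤s z≤n))

    suc-c<T : suc c < T
    suc-c<T = <-≤-trans (m<m+n (suc c) (s≤s z≤n)) inner-fits

    -- If block c is mixed, its first letter is determined by its second one, so the
    -- first letters of the 3q blocks from c are periodic, contradicting the period condition.
    from-mixed : Mixed c → ⊥
    from-mixed mc = no-blockPeriod c q (double q + q) (s≤s z≤n) (three-periods-condition q (s≤s z≤n)) fits extended all-mixed
      where
      all-mixed : ∀ j → j < double q + q → Mixed (c + j)
      all-mixed zero _ = subst Mixed (sym (+-identityʳ c)) mc
      all-mixed (suc j) l = subst Mixed (sym (+-suc c j))
        (inner-mixed j (≤-pred (≤-trans l (≤-reflexive (+-suc (double q) q₁)))))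
      extended : FirstPeriod c q (double q + q)
      extended zero l = mapNot-injective (trans (sym (mixed-second start)) (trans (second 0 l) (mixed-second partner)))
        where
        start : Mixed (c + 0)
        start = subst Mixed (sym (+-identityʳ c)) mc
        partner : Mixed (c + 0 + q)
        partner = subst Mixed (sym (trans (cong (_+ q) (+-identityʳ c)) (+-suc c q₁)))
          (inner-mixed q₁ (s≤s (≤-trans (m≤n+m q₁ (double q₁)) (n≤1+n _))))
      extended (suc j) l = trans (cong (λ z → W ! double z) (+-suc c j))
        (trans (first j (<-trans (n<1+n (j + q)) l)) (cong (λ z → W ! double (z + q)) (sym (+-suc c j))))

    long-period : 2 ≤ q₁ → ⊥
    long-period 2≤q₁ = no-blockPeriod (suc c) q (double q + q₁) (s≤s z≤n) (inj₂ condition) inner-fits (proj₁ inner) inner-mixed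
      where
      condition : suc (double q) < double q + q₁
      condition = ≤-trans (≤-reflexive (+-comm 2 (double q))) (+-monoʳ-≤ (double q) 2≤q₁)

    -- If block c is the constant block d1, the blocks from c + 1 = shift start the second
    -- copy of μ y; for q = 1 and q = 2 the periods contradict y = 10….
    after-d1 : c ≡ d1 → q₁ ≤ 1 → ⊥
    after-d1 refl z≤n = clash (trans (copy₂-first 0 (s≤s z≤n)) y-first)
      (trans (cong (λ z → W ! double (z + 1)) (+-identityʳ shift)) (trans (copy₂-first 1 (s≤s (s≤s z≤n))) y-second))
      (first 0 (s≤s (s≤s z≤n)))
    after-d1 refl (s≤s z≤n) = clash
      (trans (cong (λ z → W ! suc (double z)) (position m)) (trans (copy₂-second 1 (s≤s (s≤s z≤n))) (cong (Mb.map not) y-second)))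
      (trans (cong (λ z → W ! suc (double z)) (+-identityʳ d1)) d1-second)
      (sym (second 0 (s≤s (s≤s (s≤s z≤n)))))
      where
      position : ∀ m → suc (suc m) + 0 + 2 ≡ suc (suc (suc m)) + 1
      position = solve-∀

    impossible : ⊥
    impossible with classify c (<-trans (n<1+n c) suc-c<T)
    ... | inj₁ mc = from-mixed mc
    ... | inj₂ cb with q₁ ≤? 1
    ...   | yes q₁≤1 = after-d1 (constant-before-mixed c cb inner-start suc-c<T) q₁≤1
    ...   | no q₁≰1 = long-period (≰⇒> q₁≰1)

  no-cube : ∀ i p → 1 ≤ p → CubeAt W i p → i + (p + (p + p)) ≤ double T → ⊥
  no-cube i p 1≤p cube bnd with even-or-odd p
  ... | inj₂ (zero , refl) = no-cube-period1 i cube bnd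
  ... | inj₂ (suc h , refl) = no-oddCube i h cube bnd
  ... | inj₁ (zero , refl) with 1≤p
  ...   | ()
  no-cube i p 1≤p cube bnd | inj₁ (suc q₁ , refl) with even-or-odd i
  ... | inj₁ (a , refl) = no-evenCube-evenStart a (suc q₁) (s≤s z≤n) cube bnd
  ... | inj₂ (c , refl) = OddStart.impossible c q₁ cube bnd

  cubefree : Cubefree W
  cubefree (u , u≢[] , P , S , occurrence) = no-cube (length P) (length u) (nonEmpty u u≢[])
    (subst (λ w → CubeAt w (length P) (length u)) (sym occurrence) (cube-period P u S))
    (subst (length P + (length u + (length u + length u)) ≤_) (trans (cong length (sym occurrence)) length-W) (cube-fits P u S))
    where
    nonEmpty : ∀ (u : Word) → u ≢ [] → 1 ≤ length u
    nonEmpty [] ne = ⊥-elim (ne refl)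
    nonEmpty (_ ∷ _) _ = s≤s z≤n

no-1001-in-0 : ∀ x'' P S → false ∷ [] ≢ P ++ (w1001 ++ x'') ++ S
no-1001-in-0 x'' [] S ()
no-1001-in-0 x'' (p ∷ []) S ()
no-1001-in-0 x'' (p ∷ _ ∷ _) S ()

theorem8 : (x : Word) → FactorOfTM x →
    ∃[ x'' ] (x ≡ w1001 ++ x'') → ∃[ x' ] (x ≡ x' ++ w1001) →
    Cubefree (x ++ w101100 ++ x ++ w101100)
theorem8 x (zero , P , S , occ) (x'' , refl) _ = ⊥-elim (no-1001-in-0 x'' P S occ)
theorem8 x (suc k , occ) starts ends with μ-desubstitute (μ^ k [0]) x occ starts ends
... | y , refl , (p , s , factor) , (y'' , y-start) , (y' , y-end) =
  subst Cubefree (++-assoc (μ y) w101100 (μ y ++ w101100)) (CubeFreeness.cubefree y y' y'' y-start y-end y-overlapFree)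
  where
  y-overlapFree : OverlapFree y
  y-overlapFree = overlapFree-factor p y s (subst OverlapFree factor (thueMorse-overlapFree k))
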